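{- The class of disconnected $(P_1+\overline{P_1+P_3})$-free chordal graphs has bounded clique-width.
   Context: All graphs are finite, simple and undirected. $G$ is $H$-free if it has no induced subgraph isomorphic to $H$. A graph is chordal if it contains no induced cycle $C_r$ with $r\geq 4$. $P_r$ is the path on $r$ vertices, $+$ denotes disjoint union and $\overline{G}$ the complement; $\overline{P_1+P_3}$ is the paw (a triangle with one pendant vertex). The clique-width of a graph $G$ is the minimum number $k$ of labels needed to construct $G$ using the operations: create a single vertex with label $i$; take the disjoint union of two labelled graphs; add all edges between vertices of label $i$ and vertices of label $j$ ($i\neq j$); rename label $i$ to $j$. A class of graphs has bounded clique-width if there is a constant $c$ such that every graph in the class has clique-width at most $c$. -}

module Defs where

open import Data.Nat using (ℕ; zero; suc; _+_; _≤_; _≡ᵇ_)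
open import Data.Fin using (Fin; toℕ; splitAt; _↑ˡ_; _↑ʳ_)
import Data.Fin as F
open import Data.Bool using (Bool; true; false; _∧_; _∨_; not; if_then_else_)
open import Data.Sum using (_⊎_; inj₁; inj₂)
open import Data.Product using (Σ; ∃; ∃-syntax; _×_; _,_)
open import Data.Empty using (⊥)
open import Relation.Nullary using (¬_)
open import Relation.Nullary.Decidable using (⌊_⌋)
open import Relation.Binary.PropositionalEquality using (_≡_; _≢_)
open import Function.Definitions using (Injective)
open import Data.Fin.Permutation using (Permutation′; _⟨$⟩ʳ_)

record Graph : Set where
  constructor graph
  field
    size : ℕ
    adj  : Fin size → Fin size → Bool
open Graph public

IsSimple : Graph → Set
IsSimple G = (∀ u v → adj G u v ≡ adj G v u) × (∀ u → adj G u u ≡ false)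

_==_ : ∀ {n} → Fin n → Fin n → Bool
i == j = ⌊ i F.≟ j ⌋

P : ℕ → Graph
P r = graph r (λ i j → (suc (toℕ i) ≡ᵇ toℕ j) ∨ (suc (toℕ j) ≡ᵇ toℕ i))

C : ℕ → Graph
C r = graph r (λ i j → (suc (toℕ i) ≡ᵇ toℕ j) ∨ (suc (toℕ j) ≡ᵇ toℕ i)
                     ∨ ((toℕ i ≡ᵇ 0) ∧ (suc (toℕ j) ≡ᵇ r))
                     ∨ ((toℕ j ≡ᵇ 0) ∧ (suc (toℕ i) ≡ᵇ r)))

_⊹_ : Graph → Graph → Graph
G ⊹ H = graph (size G + size H) e
  where
  e : Fin (size G + size H) → Fin (size G + size H) → Bool
  e u v with splitAt (size G) u | splitAt (size G) v
  ... | inj₁ a | inj₁ b = adj G a b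
  ... | inj₂ a | inj₂ b = adj H a b
  ... | _      | _      = false

co : Graph → Graph
co G = graph (size G) (λ u v → not (adj G u v) ∧ not (u == v))

paw : Graph
paw = co (P 1 ⊹ P 3)

InducedSub : Graph → Graph → Set
InducedSub H G = Σ (Fin (size H) → Fin (size G)) λ f →
  Injective _≡_ _≡_ f × (∀ i j → adj H i j ≡ adj G (f i) (f j))

Free : Graph → Graph → Set
Free H G = ¬ InducedSub H G

Chordal : Graph → Set
Chordal G = ∀ r → 4 ≤ r → Free (C r) G

data Reach (G : Graph) : Fin (size G) → Fin (size G) → Set where
  here : ∀ {u} → Reach G u u
  step : ∀ {u v w} → adj G u v ≡ true → Reach G v w → Reach G u w

Connected : Graph → Set
Connected G = ∀ u v → Reach G u v

Disconnected : Graph → Set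
Disconnected G = ¬ Connected G

data Expr (k : ℕ) : ℕ → Set where
  vtx : Fin k → Expr k 1
  _⊕_ : ∀ {m n} → Expr k m → Expr k n → Expr k (m + n)
  η   : ∀ {n} (i j : Fin k) → i ≢ j → Expr k n → Expr k n
  ρ   : ∀ {n} (i j : Fin k) → Expr k n → Expr k n

label : ∀ {k n} → Expr k n → Fin n → Fin k
edge  : ∀ {k n} → Expr k n → Fin n → Fin n → Bool

label (vtx i) _ = i
label (_⊕_ {m} e₁ e₂) u with splitAt m u
... | inj₁ a = label e₁ a
... | inj₂ b = label e₂ b
label (η i j _ e) u = label e u
label (ρ i j e) u = if label e u == i then j else label e u

edge (vtx i) _ _ = false
edge (_⊕_ {m} e₁ e₂) u v with splitAt m u | splitAt m v
... | inj₁ a | inj₁ b = edge e₁ a b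
... | inj₂ a | inj₂ b = edge e₂ a b
... | _      | _      = false
edge (η i j _ e) u v = edge e u v
  ∨ ((label e u == i) ∧ (label e v == j))
  ∨ ((label e u == j) ∧ (label e v == i))
edge (ρ i j e) u v = edge e u v

CW≤ : ℕ → Graph → Set
CW≤ k G = Σ (Expr k (size G)) λ e → Σ (Permutation′ (size G)) λ π →
  ∀ u v → edge e u v ≡ adj G (π ⟨$⟩ʳ u) (π ⟨$⟩ʳ v)

module Submission where

-- Since G is disconnected, every component K misses some vertex z;
-- z together with an induced paw inside K would induce P₁ + paw, so each component of G
-- is paw-free.  Two structural facts about vertex sets S of G follow.
--  * Forests: by chordality, if two distinct neighbours of x are joined by a walk avoiding
--    x, then x forms a triangle with two vertices of that walk (a shortest such walk closes
--    an induced cycle of length ≥ 4 unless it is a single edge).  Hence a triangle-free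
--    G[S] is a forest.
--  * Apexes: a connected paw-free set C containing a triangle a b c has a universal vertex:
--    every vertex of C is one of a, b, c or sees two of them (otherwise it is the pendant
--    vertex of a paw), and then a or b is adjacent to all of C (otherwise a paw or an
--    induced C₄ appears).
-- A 3-expression for every non-empty G[S] is built by induction on |S|.  A forest is built
-- rooted at a vertex x (the root alone carries label 0): the component D of a neighbour y
-- in S ∖ {x} and the rest S ∖ D are built recursively and the single edge x y is added by
-- one join.  Otherwise the component C of a triangle is built from C minus its universal
-- vertex by one join, and the rest S ∖ C is added by disjoint union.  Taking S = V(G)
-- gives the theorem with c = 3.


open import Defs
open import Data.Nat using (ℕ; zero; suc; _+_; _≤_; _<_; z≤n; s≤s; _≡ᵇ_; _<?_)
open import Data.Nat.Properties
  using (≤-trans; ≤-antisym; ≤-pred; <⇒≤; m≤m+n; m≤n+m; m<m+n; +-suc; +-identityʳ; +-monoˡ-≤; +-monoˡ-<; <⇒≱;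
         m≤n⇒m≤1+n; m≤n⇒m<n∨m≡n; m≤n⇒∃[o]m+o≡n; anyUpTo?; <-cmp; ≤-refl; ≡ᵇ⇒≡; ≡⇒≡ᵇ; <⇒≢)
  renaming (_≤?_ to _≤ℕ?_)
open import Data.Nat.Tactic.RingSolver using (solve-∀)
open import Data.Fin as F using (Fin; toℕ; splitAt; _↑ˡ_; _↑ʳ_)
open import Data.Fin.Patterns using (0F; 1F; 2F; 3F; 4F)
open import Data.Fin.Properties
  using (any?; all?; injective⇒≤; ¬Fin0; toℕ-injective; toℕ<n; splitAt-↑ˡ; splitAt-↑ʳ; splitAt⁻¹-↑ˡ; splitAt⁻¹-↑ʳ)
open import Data.Bool using (Bool; true; false; T; _∧_; _∨_; not; if_then_else_)
import Data.Bool.Properties as Bool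
open import Data.Unit using (tt)
open import Data.Product using (∃; _×_; _,_; proj₁; proj₂)
open import Data.Sum using (_⊎_; inj₁; inj₂; [_,_]′)
open import Data.Empty using (⊥; ⊥-elim)
open import Relation.Nullary using (¬?; yes; no; does; Dec)
open import Relation.Nullary.Decidable using (dec-true; map′; from-yes; _×-dec_; _⊎-dec_; _→-dec_)
open import Relation.Binary using (tri<; tri≈; tri>)
open import Relation.Binary.PropositionalEquality
open ≡-Reasoning
open import Function using (_∘_)
open import Function.Bundles using (mk⇔; mk↔ₛ′)

true≢false : ∀ {b : Bool} → b ≡ true → b ≡ false → ⊥
true≢false refl ()

∨-false-l : ∀ {a b : Bool} → a ≡ false → a ∨ b ≡ b
∨-false-l refl = refl

∨-false-r : ∀ {a b : Bool} → b ≡ false → a ∨ b ≡ a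
∨-false-r {a} refl = Bool.∨-identityʳ a

∨-falses : ∀ x {y z : Bool} → y ≡ false → z ≡ false → x ∨ y ∨ z ≡ x
∨-falses x refl refl = ∨-false-r refl

∧-false-l : ∀ {a b : Bool} → a ≡ false → a ∧ b ≡ false
∧-false-l refl = refl

∧-false-r : ∀ {a b : Bool} → b ≡ false → a ∧ b ≡ false
∧-false-r {a} refl = Bool.∧-zeroʳ a

∧-intro : ∀ {a b : Bool} → a ≡ true → b ≡ true → a ∧ b ≡ true
∧-intro refl refl = refl

∨-inj₂ : ∀ a {b : Bool} → b ≡ true → a ∨ b ≡ true
∨-inj₂ true _ = refl
∨-inj₂ false e = e

∨-true : ∀ {a b : Bool} → a ∨ b ≡ true → a ≡ true ⊎ b ≡ true
∨-true {true} _ = inj₁ refl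
∨-true {false} e = inj₂ e

==-refl : ∀ {n} (i : Fin n) → (i == i) ≡ true
==-refl i with i F.≟ i
... | yes _ = refl
... | no i≢i = ⊥-elim (i≢i refl)

==⇒≡ : ∀ {n} {i j : Fin n} → (i == j) ≡ true → i ≡ j
==⇒≡ {i = i} {j} e with i F.≟ j
... | yes i≡j = i≡j

≢⇒==-false : ∀ {n} {i j : Fin n} → i ≢ j → (i == j) ≡ false
≢⇒==-false {i = i} {j} i≢j with i F.≟ j
... | yes i≡j = ⊥-elim (i≢j i≡j)
... | no _ = refl

search : ∀ {n} (p : Fin n → Bool) → (∃ λ i → p i ≡ true) ⊎ (∀ i → p i ≡ false)
search p with any? (λ i → p i Bool.≟ true)
... | yes found = inj₁ found
... | no none = inj₂ λ i → Bool.¬-not λ pi → none (i , pi)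

anyᵇ : ∀ {n} → (Fin n → Bool) → Bool
anyᵇ p = does (any? (λ i → p i Bool.≟ true))

anyᵇ-sound : ∀ {n} (p : Fin n → Bool) → anyᵇ p ≡ true → ∃ λ i → p i ≡ true
anyᵇ-sound p e with any? (λ i → p i Bool.≟ true)
... | yes found = found

anyᵇ-complete : ∀ {n} (p : Fin n → Bool) i → p i ≡ true → anyᵇ p ≡ true
anyᵇ-complete p i pi = dec-true (any? (λ i → p i Bool.≟ true)) (i , pi)

VSet : ℕ → Set
VSet n = Fin n → Bool

module _ {n : ℕ} where

  infix 4 _∈_ _∉_ _⊆_

  _∈_ _∉_ : Fin n → VSet n → Set
  v ∈ S = S v ≡ true
  v ∉ S = S v ≡ false

  _⊆_ : VSet n → VSet n → Set
  S ⊆ T = ∀ v → v ∈ S → v ∈ T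

  ⁅_⁆ : Fin n → VSet n
  ⁅ x ⁆ v = v == x

  _∖_ : VSet n → VSet n → VSet n
  (S ∖ T) v = S v ∧ not (T v)

  ∈⁅⁆⇒≡ : ∀ {x v} → v ∈ ⁅ x ⁆ → v ≡ x
  ∈⁅⁆⇒≡ = ==⇒≡

  x∈⁅x⁆ : ∀ x → x ∈ ⁅ x ⁆
  x∈⁅x⁆ = ==-refl

  ∖-⊆ : ∀ S T → S ∖ T ⊆ S
  ∖-⊆ S T v = Bool.∧-conicalˡ (S v) _

  ∖-∉ : ∀ S T {v} → v ∈ T → v ∉ S ∖ T
  ∖-∉ S T {v} v∈T rewrite v∈T = Bool.∧-zeroʳ (S v)

  ∖-∈ : ∀ S T {v} → v ∈ S → v ∉ T → v ∈ S ∖ T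
  ∖-∈ S T v∈S v∉T rewrite v∈S | v∉T = refl

  ∖-excl : ∀ S T {v} → v ∈ S ∖ T → v ∉ T
  ∖-excl S T {v} v∈ with T v
  ... | false = refl
  ... | true = ⊥-elim (true≢false v∈ (Bool.∧-zeroʳ (S v)))

  ∈-split : ∀ S P {v} → v ∈ S → v ∈ P ⊎ v ∈ S ∖ P
  ∈-split S P {v} v∈S with P v
  ... | true = inj₁ refl
  ... | false rewrite v∈S = inj₂ refl

  ∉⁅⁆ : ∀ {x v} → v ≢ x → v ∉ ⁅ x ⁆
  ∉⁅⁆ = ≢⇒==-false

  ∖⁅⁆-≢ : ∀ S {x v} → v ∈ S ∖ ⁅ x ⁆ → v ≢ x
  ∖⁅⁆-≢ S {x} {v} v∈ refl = true≢false (x∈⁅x⁆ v) (∖-excl S ⁅ v ⁆ v∈)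

∣_∣ : ∀ {n} → VSet n → ℕ
∣_∣ {zero} S = 0
∣_∣ {suc n} S = (if S F.zero then 1 else 0) + ∣ S ∘ F.suc ∣

∣∣≤n : ∀ {n} (S : VSet n) → ∣ S ∣ ≤ n
∣∣≤n {zero} S = z≤n
∣∣≤n {suc n} S with S F.zero
... | true = s≤s (∣∣≤n (S ∘ F.suc))
... | false = m≤n⇒m≤1+n (∣∣≤n (S ∘ F.suc))

∣∣-mono : ∀ {n} {S T : VSet n} → S ⊆ T → ∣ S ∣ ≤ ∣ T ∣
∣∣-mono {zero} _ = z≤n
∣∣-mono {suc n} {S} {T} S⊆T with S F.zero in s0 | T F.zero in t0
... | true  | true  = s≤s (∣∣-mono (S⊆T ∘ F.suc))
... | true  | false = ⊥-elim (true≢false (S⊆T F.zero s0) t0)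
... | false | true  = m≤n⇒m≤1+n (∣∣-mono (S⊆T ∘ F.suc))
... | false | false = ∣∣-mono (S⊆T ∘ F.suc)

∣∣-mono-< : ∀ {n} {S T : VSet n} {x} → S ⊆ T → x ∉ S → x ∈ T → ∣ S ∣ < ∣ T ∣
∣∣-mono-< {suc n} {S} {T} {F.zero} S⊆T x∉S x∈T rewrite x∉S | x∈T = s≤s (∣∣-mono (S⊆T ∘ F.suc))
∣∣-mono-< {suc n} {S} {T} {F.suc x} S⊆T x∉S x∈T with S F.zero in s0 | T F.zero in t0
... | true  | true  = s≤s (∣∣-mono-< (S⊆T ∘ F.suc) x∉S x∈T)
... | true  | false = ⊥-elim (true≢false (S⊆T F.zero s0) t0)
... | false | true  = m≤n⇒m≤1+n (∣∣-mono-< (S⊆T ∘ F.suc) x∉S x∈T)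
... | false | false = ∣∣-mono-< (S⊆T ∘ F.suc) x∉S x∈T

≡ᵇ-true⇒≡ : ∀ {m n} → (m ≡ᵇ n) ≡ true → m ≡ n
≡ᵇ-true⇒≡ {m} {n} e = ≡ᵇ⇒≡ m n (subst T (sym e) tt)

≡⇒≡ᵇ-true : ∀ {m n} → m ≡ n → (m ≡ᵇ n) ≡ true
≡⇒≡ᵇ-true {m} {n} m≡n with m ≡ᵇ n | ≡⇒≡ᵇ m n m≡n
... | true | _ = refl

pairs? : ∀ {Q : ℕ → ℕ → Set} → (∀ i j → Dec (Q i j)) → ∀ len →
         Dec (∃ λ i → ∃ λ j → i < j × j ≤ len × Q i j)
pairs? {Q} Q? len = map′ to from (anyUpTo? (λ j → anyUpTo? (λ i → Q? i j) j) (suc len))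
  where
  Pairs : Set
  Pairs = ∃ λ i → ∃ λ j → i < j × j ≤ len × Q i j
  to : (∃ λ j → j < suc len × ∃ λ i → i < j × Q i j) → Pairs
  to (j , s≤s j≤len , i , i<j , q) = i , j , i<j , j≤len , q
  from : Pairs → ∃ λ j → j < suc len × ∃ λ i → i < j × Q i j
  from (i , j , i<j , j≤len , q) = j , s≤s j≤len , i , i<j , q

CycAdj : ℕ → ℕ → ℕ → Set
CycAdj r a b = suc a ≡ b ⊎ suc b ≡ a ⊎ (a ≡ 0 × suc b ≡ r) ⊎ (b ≡ 0 × suc a ≡ r)

CycAdj-sym : ∀ {r a b} → CycAdj r a b → CycAdj r b a
CycAdj-sym (inj₁ e) = inj₂ (inj₁ e)
CycAdj-sym (inj₂ (inj₁ e)) = inj₁ e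
CycAdj-sym (inj₂ (inj₂ (inj₁ e))) = inj₂ (inj₂ (inj₂ e))
CycAdj-sym (inj₂ (inj₂ (inj₂ e))) = inj₂ (inj₂ (inj₁ e))

C-adj⇒CycAdj : ∀ r (i j : Fin r) → adj (C r) i j ≡ true → CycAdj r (toℕ i) (toℕ j)
C-adj⇒CycAdj r i j e with ∨-true {suc (toℕ i) ≡ᵇ toℕ j} e
... | inj₁ e₁ = inj₁ (≡ᵇ-true⇒≡ e₁)
... | inj₂ e′ with ∨-true {suc (toℕ j) ≡ᵇ toℕ i} e′
...   | inj₁ e₂ = inj₂ (inj₁ (≡ᵇ-true⇒≡ e₂))
...   | inj₂ e″ with ∨-true {(toℕ i ≡ᵇ 0) ∧ (suc (toℕ j) ≡ᵇ r)} e″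
...     | inj₁ e₃ = inj₂ (inj₂ (inj₁ (≡ᵇ-true⇒≡ (Bool.∧-conicalˡ _ _ e₃) , ≡ᵇ-true⇒≡ (Bool.∧-conicalʳ _ _ e₃))))
...     | inj₂ e₄ = inj₂ (inj₂ (inj₂ (≡ᵇ-true⇒≡ (Bool.∧-conicalˡ _ _ e₄) , ≡ᵇ-true⇒≡ (Bool.∧-conicalʳ _ _ e₄))))

CycAdj⇒C-adj : ∀ r (i j : Fin r) → CycAdj r (toℕ i) (toℕ j) → adj (C r) i j ≡ true
CycAdj⇒C-adj r i j (inj₁ e) rewrite ≡⇒≡ᵇ-true e = refl
CycAdj⇒C-adj r i j (inj₂ (inj₁ e)) rewrite ≡⇒≡ᵇ-true e = ∨-inj₂ (suc (toℕ i) ≡ᵇ toℕ j) refl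
CycAdj⇒C-adj r i j (inj₂ (inj₂ (inj₁ (e₁ , e₂)))) rewrite ≡⇒≡ᵇ-true e₁ | ≡⇒≡ᵇ-true e₂ =
  ∨-inj₂ (suc (toℕ i) ≡ᵇ toℕ j) (∨-inj₂ (suc (toℕ j) ≡ᵇ toℕ i) refl)
CycAdj⇒C-adj r i j (inj₂ (inj₂ (inj₂ (e₁ , e₂)))) rewrite ≡⇒≡ᵇ-true e₁ | ≡⇒≡ᵇ-true e₂ =
  ∨-inj₂ (suc (toℕ i) ≡ᵇ toℕ j) (∨-inj₂ (suc (toℕ j) ≡ᵇ toℕ i) (∨-inj₂ ((toℕ i ≡ᵇ 0) ∧ (suc (toℕ j) ≡ᵇ r)) refl))

module _ (G : Graph) (simple : IsSimple G) where

  private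
    n : ℕ
    n = size G

  V : Set
  V = Fin n

  A : V → V → Bool
  A = adj G

  A-sym : ∀ u v → A u v ≡ A v u
  A-sym = proj₁ simple

  A-irrefl : ∀ u → A u u ≡ false
  A-irrefl = proj₂ simple

  A-swap : ∀ {u v b} → A u v ≡ b → A v u ≡ b
  A-swap {u} {v} e = trans (A-sym v u) e

  A⇒≢ : ∀ {u v} → A u v ≡ true → u ≢ v
  A⇒≢ {u} e refl = true≢false e (A-irrefl u)

  -- A walk a = v₀ ~ v₁ ~ ⋯ ~ vₖ = b whose vertices after a all lie in S.
  data Walk (S : VSet n) : V → V → Set where
    []  : ∀ {a} → Walk S a a
    _∷_ : ∀ {a b c} → (b ∈ S × A a b ≡ true) → Walk S b c → Walk S a c

  infixr 5 _∷_

  _∷ʳ_ : ∀ {S a b c} → Walk S a b → (c ∈ S × A b c ≡ true) → Walk S a c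
  [] ∷ʳ e = e ∷ []
  (e ∷ w) ∷ʳ e′ = e ∷ (w ∷ʳ e′)

  walk-mono : ∀ {S T a b} → S ⊆ T → Walk S a b → Walk T a b
  walk-mono S⊆T [] = []
  walk-mono S⊆T ((b∈S , ab) ∷ w) = (S⊆T _ b∈S , ab) ∷ walk-mono S⊆T w

  record Component (S : VSet n) (y : V) : Set where
    field
      members : VSet n
      root    : y ∈ members
      inside  : members ⊆ S
      reach   : ∀ v → v ∈ members → Walk members y v
      closed  : ∀ {u v} → u ∈ members → v ∈ S → A u v ≡ true → v ∈ members

  frontier : (S R : VSet n) →
             (∃ λ v → ∃ λ u → v ∈ S ∖ R × u ∈ R × A u v ≡ true) ⊎
             (∀ {u v} → u ∈ R → v ∈ S → A u v ≡ true → v ∈ R)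
  frontier S R with search (λ v → (S ∖ R) v ∧ anyᵇ (λ u → R u ∧ A u v))
  ... | inj₁ (v , e) with anyᵇ-sound _ (Bool.∧-conicalʳ _ _ e)
  ...   | u , e′ = inj₁ (v , u , Bool.∧-conicalˡ _ _ e , Bool.∧-conicalˡ _ _ e′ , Bool.∧-conicalʳ _ _ e′)
  frontier S R | inj₂ none = inj₂ closed
    where
    closed : ∀ {u v} → u ∈ R → v ∈ S → A u v ≡ true → v ∈ R
    closed {u} {v} u∈R v∈S uv with R v in eq
    ... | true = refl
    ... | false = ⊥-elim (true≢false found (none v))
      where
      found : (S ∖ R) v ∧ anyᵇ (λ u → R u ∧ A u v) ≡ true
      found rewrite ∖-∈ S R v∈S eq
                  | anyᵇ-complete (λ u → R u ∧ A u v) u (subst (λ b → b ∧ A u v ≡ true) (sym u∈R) uv) = refl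

  -- Exploration from y: each round adds one vertex of S adjacent to R, so n rounds suffice.
  explore : ∀ {S y} (rounds : ℕ) (R : VSet n) → y ∈ R → R ⊆ S → (∀ v → v ∈ R → Walk R y v) →
            n ≤ ∣ R ∣ + rounds → Component S y
  explore {S} {y} rounds R y∈R R⊆S reach bound with frontier S R
  ... | inj₂ closed = record { members = R ; root = y∈R ; inside = R⊆S ; reach = reach ; closed = closed }
  ... | inj₁ (v , u , v∈S∖R , u∈R , uv) = continue rounds bound
    where
    R′ : VSet n
    R′ w = R w ∨ (w == v)
    R⊆R′ : R ⊆ R′
    R⊆R′ w w∈R rewrite w∈R = refl
    v∈R′ : v ∈ R′
    v∈R′ rewrite ==-refl v = Bool.∨-zeroʳ (R v)
    R′⊆S : R′ ⊆ S
    R′⊆S w w∈R′ with ∨-true {R w} w∈R′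
    ... | inj₁ w∈R = R⊆S w w∈R
    ... | inj₂ w≡v rewrite ==⇒≡ w≡v = ∖-⊆ S R v v∈S∖R
    reach′ : ∀ w → w ∈ R′ → Walk R′ y w
    reach′ w w∈R′ with ∨-true {R w} w∈R′
    ... | inj₁ w∈R = walk-mono R⊆R′ (reach w w∈R)
    ... | inj₂ w≡v rewrite ==⇒≡ w≡v = walk-mono R⊆R′ (reach u u∈R) ∷ʳ (v∈R′ , uv)
    grows : ∣ R ∣ < ∣ R′ ∣
    grows = ∣∣-mono-< R⊆R′ (∖-excl S R v∈S∖R) v∈R′
    continue : (k : ℕ) → n ≤ ∣ R ∣ + k → Component S y
    continue zero b = ⊥-elim (<⇒≱ grows (≤-trans (∣∣≤n R′) (subst (n ≤_) (+-identityʳ _) b)))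
    continue (suc k) b = explore k R′ (R⊆R′ y y∈R) R′⊆S reach′
                           (≤-trans b (subst (_≤ ∣ R′ ∣ + k) (sym (+-suc _ k)) (+-monoˡ-≤ k grows)))

  component : ∀ S y → y ∈ S → Component S y
  component S y y∈S = explore n ⁅ y ⁆ (x∈⁅x⁆ y) ⁅y⁆⊆S reach (m≤n+m n _)
    where
    ⁅y⁆⊆S : ⁅ y ⁆ ⊆ S
    ⁅y⁆⊆S v v∈ rewrite ∈⁅⁆⇒≡ v∈ = y∈S
    reach : ∀ v → v ∈ ⁅ y ⁆ → Walk ⁅ y ⁆ y v
    reach v v∈ rewrite ∈⁅⁆⇒≡ v∈ = []

  -- The whole vertex set; components of G are components of G[everything].
  everything : VSet n
  everything _ = true

  Reach-trans : ∀ {u v w} → Reach G u v → Reach G v w → Reach G u w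
  Reach-trans here r = r
  Reach-trans (step e r) r′ = step e (Reach-trans r r′)

  Reach-sym : ∀ {u v} → Reach G u v → Reach G v u
  Reach-sym here = here
  Reach-sym (step e r) = Reach-trans (Reach-sym r) (step (A-swap e) here)

  walk⇒Reach : ∀ {S u v} → Walk S u v → Reach G u v
  walk⇒Reach [] = here
  walk⇒Reach ((_ , e) ∷ w) = step e (walk⇒Reach w)

  outside : Disconnected G → ∀ a → ∃ λ z → z ∉ Component.members (component everything a refl)
  outside disconnected a = by-search (search (λ v → not (members v)))
    where
    open Component (component everything a refl)
    by-search : (∃ λ z → not (members z) ≡ true) ⊎ (∀ v → not (members v) ≡ false) → ∃ λ z → z ∉ members
    by-search (inj₁ (z , z∉)) = z , Bool.not-injective z∉
    by-search (inj₂ none) = ⊥-elim (disconnected λ u v → Reach-trans (Reach-sym (from-a u)) (from-a v))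
      where
      from-a : ∀ v → Reach G a v
      from-a v = walk⇒Reach (reach v (Bool.not-injective (none v)))

  walk-stays : ∀ {S y v} (K : Component S y) → Walk S y v → v ∈ Component.members K
  walk-stays {S} K = along (Component.root K)
    where
    along : ∀ {u v} → u ∈ Component.members K → Walk S u v → v ∈ Component.members K
    along u∈K [] = u∈K
    along u∈K ((w∈S , uw) ∷ walk) = along (Component.closed K u∈K w∈S uw) walk

  record IWalk (P : V → Set) (len : ℕ) (g : ℕ → V) : Set where
    field
      on   : ∀ k → k ≤ len → P (g k)
      adjacent : ∀ k → k < len → A (g k) (g (suc k)) ≡ true

  record Detour (P : V → Set) (x : V) (len : ℕ) (g : ℕ → V) : Set where
    field
      walk     : IWalk P len g
      distinct : g 0 ≢ g len
      start    : A x (g 0) ≡ true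
      end      : A x (g len) ≡ true

  TriangleOver : (V → Set) → V → Set
  TriangleOver P x = ∃ λ p → ∃ λ q → P p × P q × A x p ≡ true × A x q ≡ true × A p q ≡ true

  record Reduced (x : V) (len : ℕ) (g : ℕ → V) : Set where
    field
      no-repeat : ∀ {i j} → i < j → j ≤ len → g i ≢ g j
      no-chord  : ∀ {i j} → suc i < j → j ≤ len → A (g i) (g j) ≡ false
      no-inner  : ∀ {k} → 0 < k → k < len → A x (g k) ≡ false

  prefix : ∀ {P len g} k → k ≤ len → IWalk P len g → IWalk P k g
  prefix k k≤len w = record
    { on = λ i i≤k → IWalk.on w i (≤-trans i≤k k≤len)
    ; adjacent = λ i i<k → IWalk.adjacent w i (≤-trans i<k k≤len) }

  skip : ℕ → ℕ → (ℕ → V) → ℕ → V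
  skip i d g k with k ≤ℕ? i
  ... | yes _ = g k
  ... | no  _ = g (k + d)

  skip-≤ : ∀ {i d g k} → k ≤ i → skip i d g k ≡ g k
  skip-≤ {i} {k = k} k≤i with k ≤ℕ? i
  ... | yes _ = refl
  ... | no k≰i = ⊥-elim (k≰i k≤i)

  skip-> : ∀ {i d g k} → i < k → skip i d g k ≡ g (k + d)
  skip-> {i} {k = k} i<k with k ≤ℕ? i
  ... | yes k≤i = ⊥-elim (<⇒≢ (≤-trans i<k k≤i) refl)
  ... | no _ = refl

  skip-detour : ∀ {P x g} len d i → i < len → Detour P x (len + d) g →
                A (g i) (g (suc i + d)) ≡ true → Detour P x len (skip i d g)
  skip-detour {P} {x} {g} len d i i<len D bridge = record
    { walk = record { on = on ; adjacent = adjacent } ; distinct = distinct ; start = start ; end = end }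
    where
    open Detour D using (walk)
    on : ∀ k → k ≤ len → P (skip i d g k)
    on k k≤len with k ≤ℕ? i
    ... | yes _ = IWalk.on walk k (≤-trans k≤len (m≤m+n len d))
    ... | no _ = IWalk.on walk (k + d) (+-monoˡ-≤ d k≤len)
    adjacent : ∀ k → k < len → A (skip i d g k) (skip i d g (suc k)) ≡ true
    adjacent k k<len with <-cmp k i
    ... | tri< k<i _ _ rewrite skip-≤ {i} {d} {g} (<⇒≤ k<i) | skip-≤ {i} {d} {g} k<i =
          IWalk.adjacent walk k (≤-trans k<len (m≤m+n len d))
    ... | tri≈ _ refl _ rewrite skip-≤ {i} {d} {g} (≤-refl {k}) | skip-> {i} {d} {g} (≤-refl {suc k}) = bridge
    ... | tri> _ _ i<k rewrite skip-> {i} {d} {g} i<k | skip-> {i} {d} {g} (m≤n⇒m≤1+n i<k) =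
          IWalk.adjacent walk (k + d) (+-monoˡ-< d k<len)
    distinct : skip i d g 0 ≢ skip i d g len
    distinct rewrite skip-≤ {i} {d} {g} (z≤n {i}) | skip-> {i} {d} {g} i<len = Detour.distinct D
    start : A x (skip i d g 0) ≡ true
    start rewrite skip-≤ {i} {d} {g} (z≤n {i}) = Detour.start D
    end : A x (skip i d g len) ≡ true
    end rewrite skip-> {i} {d} {g} i<len = Detour.end D

  Shorter : (V → Set) → V → ℕ → Set
  Shorter P x len = ∃ λ len′ → ∃ λ g′ → len′ < len × Detour P x len′ g′

  shortcut : ∀ {P x len g} len′ d i → len ≡ len′ + suc d → i < len′ → Detour P x len g →
             A (g i) (g (suc i + suc d)) ≡ true → Shorter P x len
  shortcut {P} {x} {len} {g} len′ d i refl i<len′ D bridge =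
    len′ , skip i (suc d) g , m<m+n len′ (s≤s z≤n) , skip-detour len′ (suc d) i i<len′ D bridge

  cut-repeat : ∀ {P x len g i j} → Detour P x len g → i < j → j ≤ len → g i ≡ g j → Shorter P x len
  cut-repeat {P} {x} {len} {g} {i} {j} D i<j j≤len gi≡gj with m≤n⇒m<n∨m≡n j≤len
  ... | inj₂ refl = i , g , i<j , record
        { walk = prefix i (<⇒≤ i<j) (Detour.walk D)
        ; distinct = λ e → Detour.distinct D (trans e gi≡gj)
        ; start = Detour.start D
        ; end = subst (λ v → A x v ≡ true) (sym gi≡gj) (Detour.end D) }
  ... | inj₁ j<len with m≤n⇒∃[o]m+o≡n i<j | m≤n⇒∃[o]m+o≡n j<len
  ...   | e , refl | f , refl = shortcut (suc i + f) e i (lengths i e f) (s≤s (m≤m+n i f)) D bridge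
    where
    lengths : ∀ i e f → suc (suc i + e) + f ≡ suc i + f + suc e
    lengths = solve-∀
    bridge : A (g i) (g (suc i + suc e)) ≡ true
    bridge rewrite +-suc (suc i) e | gi≡gj = IWalk.adjacent (Detour.walk D) (suc i + e) j<len

  cut-chord : ∀ {P x len g i j} → Detour P x len g → suc i < j → j ≤ len → A (g i) (g j) ≡ true → Shorter P x len
  cut-chord {P} {x} {len} {g} {i} {j} D i+1<j j≤len chord with m≤n⇒∃[o]m+o≡n i+1<j | m≤n⇒∃[o]m+o≡n j≤len
  ... | e , refl | f , refl = shortcut (suc i + f) e i (lengths i e f) (s≤s (m≤m+n i f)) D bridge
    where
    lengths : ∀ i e f → suc (suc i) + e + f ≡ suc i + f + suc e
    lengths = solve-∀
    bridge : A (g i) (g (suc i + suc e)) ≡ true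
    bridge rewrite +-suc (suc i) e = chord

  Defect : (ℕ → V) → ℕ → ℕ → Set
  Defect g i j = g i ≡ g j ⊎ (suc i < j × A (g i) (g j) ≡ true)

  defect? : ∀ g i j → Dec (Defect g i j)
  defect? g i j = (g i F.≟ g j) ⊎-dec ((suc i <? j) ×-dec (A (g i) (g j) Bool.≟ true))

  shorten : ∀ {P x len g} → Detour P x len g → Shorter P x len ⊎ Reduced x len g
  shorten {P} {x} {len} {g} D with pairs? (defect? g) len
  ... | yes (i , j , i<j , j≤len , inj₁ repeat) = inj₁ (cut-repeat D i<j j≤len repeat)
  ... | yes (i , j , i<j , j≤len , inj₂ (i+1<j , chord)) = inj₁ (cut-chord D i+1<j j≤len chord)
  ... | no no-defect with anyUpTo? (λ k → (0 <? k) ×-dec (A x (g k) Bool.≟ true)) len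
  ...   | yes (k , k<len , 0<k , xk) = inj₁ (k , g , k<len , record
          { walk = prefix k (<⇒≤ k<len) (Detour.walk D)
          ; distinct = λ e → no-defect (0 , k , 0<k , <⇒≤ k<len , inj₁ e)
          ; start = Detour.start D
          ; end = xk })
  ...   | no no-inner = inj₂ record
          { no-repeat = λ i<j j≤len e → no-defect (_ , _ , i<j , j≤len , inj₁ e)
          ; no-chord = λ i+1<j j≤len → Bool.¬-not λ e → no-defect (_ , _ , <⇒≤ i+1<j , j≤len , inj₂ (i+1<j , e))
          ; no-inner = λ 0<k k<len → Bool.¬-not λ e → no-inner (_ , k<len , 0<k , e) }

  around : V → (ℕ → V) → ℕ → V
  around x g zero = x
  around x g (suc k) = g k

  -- A reduced detour around x closes an induced cycle x, g 0, …, g len.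
  module _ {P x len g} (P≢x : ∀ v → P v → v ≢ x) (D : Detour P x len g) (R : Reduced x len g) where

    private
      r : ℕ
      r = suc (suc len)
      h : ℕ → V
      h = around x g
      open Detour D
      open Reduced R

    cycle-edge : ∀ a b → a < r → b < r → CycAdj r a b → A (h a) (h b) ≡ true
    cycle-edge a b a<r b<r (inj₁ refl) = forward a b<r
      where
      forward : ∀ a → suc a < r → A (h a) (h (suc a)) ≡ true
      forward zero _ = start
      forward (suc k) (s≤s (s≤s k<len)) = IWalk.adjacent walk k k<len
    cycle-edge a b a<r b<r (inj₂ (inj₁ refl)) = A-swap (cycle-edge b a b<r a<r (inj₁ refl))
    cycle-edge a b _ _ (inj₂ (inj₂ (inj₁ (refl , refl)))) = end
    cycle-edge a b _ _ (inj₂ (inj₂ (inj₂ (refl , refl)))) = A-swap end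

    cycle-edge-increasing : ∀ a b → a < b → b < r → A (h a) (h b) ≡ true → CycAdj r a b
    cycle-edge-increasing zero (suc zero) _ _ _ = inj₁ refl
    cycle-edge-increasing zero (suc (suc k)) _ (s≤s (s≤s k<len)) e with m≤n⇒m<n∨m≡n k<len
    ... | inj₂ refl = inj₂ (inj₂ (inj₁ (refl , refl)))
    ... | inj₁ k+1<len = ⊥-elim (true≢false e (no-inner (s≤s z≤n) k+1<len))
    cycle-edge-increasing (suc k) (suc l) (s≤s k<l) (s≤s l<r) e with m≤n⇒m<n∨m≡n k<l
    ... | inj₂ refl = inj₁ refl
    ... | inj₁ k+1<l = ⊥-elim (true≢false e (no-chord k+1<l (≤-pred l<r)))

    cycle-edge⁻¹ : ∀ a b → a < r → b < r → A (h a) (h b) ≡ true → CycAdj r a b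
    cycle-edge⁻¹ a b a<r b<r e with <-cmp a b
    ... | tri< a<b _ _ = cycle-edge-increasing a b a<b b<r e
    ... | tri≈ _ refl _ = ⊥-elim (true≢false e (A-irrefl _))
    ... | tri> _ _ b<a = CycAdj-sym (cycle-edge-increasing b a b<a a<r (A-swap e))

    cycle-injective : ∀ a b → a < r → b < r → h a ≡ h b → a ≡ b
    cycle-injective zero zero _ _ _ = refl
    cycle-injective zero (suc l) _ (s≤s l≤) e = ⊥-elim (P≢x _ (IWalk.on walk l (≤-pred l≤)) (sym e))
    cycle-injective (suc k) zero (s≤s k≤) _ e = ⊥-elim (P≢x _ (IWalk.on walk k (≤-pred k≤)) e)
    cycle-injective (suc k) (suc l) (s≤s k≤) (s≤s l≤) e with <-cmp k l
    ... | tri< k<l _ _ = ⊥-elim (no-repeat k<l (≤-pred l≤) e)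
    ... | tri≈ _ k≡l _ = cong suc k≡l
    ... | tri> _ _ l<k = ⊥-elim (no-repeat l<k (≤-pred k≤) (sym e))

    reduced⇒cycle : InducedSub (C r) G
    reduced⇒cycle = f , injective , faithful
      where
      f : Fin r → V
      f i = h (toℕ i)
      injective : ∀ {i j} → f i ≡ f j → i ≡ j
      injective {i} {j} e = toℕ-injective (cycle-injective _ _ (toℕ<n i) (toℕ<n j) e)
      faithful : ∀ i j → adj (C r) i j ≡ A (f i) (f j)
      faithful i j = Bool.⇔→≡ (mk⇔
        (λ e → cycle-edge _ _ (toℕ<n i) (toℕ<n j) (C-adj⇒CycAdj r i j e))
        (λ e → CycAdj⇒C-adj r i j (cycle-edge⁻¹ _ _ (toℕ<n i) (toℕ<n j) e)))

  chordal-triangle : Chordal G → ∀ {P x len g} → (∀ v → P v → v ≢ x) → Detour P x len g → TriangleOver P x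
  chordal-triangle chordal {P} {x} {len} P≢x = go (suc len) ≤-refl
    where
    close : ∀ {len g} → Detour P x len g → Reduced x len g → TriangleOver P x
    close {zero} D _ = ⊥-elim (Detour.distinct D refl)
    close {suc zero} {g} D _ = g 0 , g 1 , IWalk.on walk 0 z≤n , IWalk.on walk 1 ≤-refl ,
                               Detour.start D , Detour.end D , IWalk.adjacent walk 0 ≤-refl
      where walk = Detour.walk D
    close {suc (suc m)} D R = ⊥-elim (chordal _ (s≤s (s≤s (s≤s (s≤s z≤n)))) (reduced⇒cycle P≢x D R))
    go : ∀ fuel {len g} → len < fuel → Detour P x len g → TriangleOver P x
    go (suc fuel) len<fuel D with shorten D
    ... | inj₁ (_ , _ , shorter , D′) = go fuel (≤-trans shorter (≤-pred len<fuel)) D′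
    ... | inj₂ R = close D R

  index-walk : ∀ {S a b} → a ∈ S → Walk S a b → ∃ λ len → ∃ λ g → IWalk (_∈ S) len g × g 0 ≡ a × g len ≡ b
  index-walk {a = a} a∈S [] = 0 , (λ _ → a) , record { on = λ _ _ → a∈S ; adjacent = λ _ () } , refl , refl
  index-walk {S} {a} a∈S ((b∈S , ab) ∷ w) with index-walk b∈S w
  ... | len , g , W , refl , g-len = suc len , g′ , record { on = on ; adjacent = adjacent } , refl , g-len
    where
    g′ : ℕ → V
    g′ zero = a
    g′ (suc k) = g k
    on : ∀ k → k ≤ suc len → g′ k ∈ S
    on zero _ = a∈S
    on (suc k) (s≤s k≤len) = IWalk.on W k k≤len
    adjacent : ∀ k → k < suc len → A (g′ k) (g′ (suc k)) ≡ true
    adjacent zero _ = ab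
    adjacent (suc k) (s≤s k<len) = IWalk.adjacent W k k<len

  TriangleFree : VSet n → Set
  TriangleFree S = ∀ {p q r} → p ∈ S → q ∈ S → r ∈ S → A p q ≡ true → A q r ≡ true → A p r ≡ true → ⊥

  TriangleFree-⊆ : ∀ {S T} → T ⊆ S → TriangleFree S → TriangleFree T
  TriangleFree-⊆ T⊆S tf p∈ q∈ r∈ = tf (T⊆S _ p∈) (T⊆S _ q∈) (T⊆S _ r∈)

  record Triangle (S : VSet n) : Set where
    constructor triangle
    field
      {a b c} : V
      a∈ : a ∈ S
      b∈ : b ∈ S
      c∈ : c ∈ S
      ab : A a b ≡ true
      bc : A b c ≡ true
      ac : A a c ≡ true

  triangle? : ∀ S → Triangle S ⊎ TriangleFree S
  triangle? S with search (λ a → S a ∧ anyᵇ (λ b → S b ∧ A a b ∧ anyᵇ (λ c → S c ∧ A b c ∧ A a c)))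
  ... | inj₁ (a , found) with anyᵇ-sound _ (Bool.∧-conicalʳ (S a) _ found)
  ...   | b , found-b with anyᵇ-sound _ (Bool.∧-conicalʳ (A a b) _ (Bool.∧-conicalʳ (S b) _ found-b))
  ...     | c , found-c = inj₁ (triangle (Bool.∧-conicalˡ (S a) _ found) (Bool.∧-conicalˡ (S b) _ found-b)
                                  (Bool.∧-conicalˡ (S c) _ found-c)
                                  (Bool.∧-conicalˡ (A a b) _ (Bool.∧-conicalʳ (S b) _ found-b))
                                  (Bool.∧-conicalˡ (A b c) _ (Bool.∧-conicalʳ (S c) _ found-c))
                                  (Bool.∧-conicalʳ (A b c) _ (Bool.∧-conicalʳ (S c) _ found-c)))
  triangle? S | inj₂ none = inj₂ λ {p} {q} {r} p∈ q∈ r∈ pq qr pr → true≢false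
    (∧-intro p∈ (anyᵇ-complete _ q (∧-intro q∈ (∧-intro pq (anyᵇ-complete _ r (∧-intro r∈ (∧-intro qr pr)))))))
    (none p)

  forest-property : Chordal G → ∀ {S x y y′} → TriangleFree S → x ∈ S → y ≢ y′ → A x y ≡ true → A x y′ ≡ true →
                    y ∈ S ∖ ⁅ x ⁆ → Walk (S ∖ ⁅ x ⁆) y y′ → ⊥
  forest-property chordal {S} {x} triangle-free x∈S y≢y′ xy xy′ y∈ w with index-walk y∈ w
  ... | len , g , W , refl , refl =
    refute (chordal-triangle chordal (λ _ → ∖⁅⁆-≢ S) (record { walk = W ; distinct = y≢y′ ; start = xy ; end = xy′ }))
    where
    refute : TriangleOver (_∈ S ∖ ⁅ x ⁆) x → ⊥
    refute (p , q , p∈ , q∈ , xp , xq , pq) = triangle-free x∈S (∖-⊆ S ⁅ x ⁆ p p∈) (∖-⊆ S ⁅ x ⁆ q q∈) xp pq xq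

  no-C4 : Chordal G → ∀ {a b c d} → A a b ≡ true → A b c ≡ true → A c d ≡ true → A d a ≡ true →
          A a c ≡ false → A b d ≡ false → a ≢ c → b ≢ d → ⊥
  no-C4 chordal {a} {b} {c} {d} ab bc cd da ac bd a≢c b≢d = refute
    (chordal-triangle chordal avoids-a
      (record { walk = record { on = on ; adjacent = adjacent } ; distinct = b≢d ; start = ab ; end = A-swap da }))
    where
    OnPath : V → Set
    OnPath v = v ≡ b ⊎ v ≡ c ⊎ v ≡ d
    avoids-a : ∀ v → OnPath v → v ≢ a
    avoids-a v (inj₁ refl) refl = A⇒≢ ab refl
    avoids-a v (inj₂ (inj₁ refl)) refl = a≢c refl
    avoids-a v (inj₂ (inj₂ refl)) refl = A⇒≢ da refl
    path : ℕ → V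
    path 0 = b
    path 1 = c
    path (suc (suc _)) = d
    on : ∀ k → k ≤ 2 → OnPath (path k)
    on 0 _ = inj₁ refl
    on 1 _ = inj₂ (inj₁ refl)
    on (suc (suc _)) _ = inj₂ (inj₂ refl)
    adjacent : ∀ k → k < 2 → A (path k) (path (suc k)) ≡ true
    adjacent 0 _ = bc
    adjacent 1 _ = cd
    adjacent (suc (suc _)) (s≤s (s≤s ()))
    -- the only neighbours of a on the path are b and d, which are not adjacent
    refute : TriangleOver OnPath a → ⊥
    refute (_ , _ , inj₂ (inj₁ refl) , _ , ap , _ , _) = true≢false ap ac
    refute (_ , _ , _ , inj₂ (inj₁ refl) , _ , aq , _) = true≢false aq ac
    refute (_ , _ , inj₁ refl , inj₁ refl , _ , _ , pq) = A⇒≢ pq refl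
    refute (_ , _ , inj₁ refl , inj₂ (inj₂ refl) , _ , _ , pq) = true≢false pq bd
    refute (_ , _ , inj₂ (inj₂ refl) , inj₁ refl , _ , _ , pq) = true≢false (A-swap pq) bd
    refute (_ , _ , inj₂ (inj₂ refl) , inj₂ (inj₂ refl) , _ , _ , pq) = A⇒≢ pq refl

  Separated : (H : Graph) → Fin (size H) → Fin (size H) → Set
  Separated H i j = adj H i j ≡ true ⊎ ∃ λ k → adj H i k ≢ adj H j k

  faithful⇒injective : ∀ H (f : Fin (size H) → V) → (∀ i j → adj H i j ≡ A (f i) (f j)) →
                       (∀ i j → i ≢ j → Separated H i j) → ∀ {i j} → f i ≡ f j → i ≡ j
  faithful⇒injective H f faithful separated {i} {j} fi≡fj with i F.≟ j
  ... | yes i≡j = i≡j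
  ... | no i≢j with separated i j i≢j
  ...   | inj₁ ij = ⊥-elim (true≢false ij (trans (faithful i j) (trans (cong (A (f i)) (sym fi≡fj)) (A-irrefl (f i)))))
  ...   | inj₂ (k , differ) =
    ⊥-elim (differ (trans (faithful i k) (trans (cong (λ v → A v (f k)) fi≡fj) (sym (faithful j k)))))

  record IsPaw (p q r s : V) : Set where
    constructor paw-shape
    field
      pq  : A p q ≡ true
      pr  : A p r ≡ true
      qr  : A q r ≡ true
      ps  : A p s ≡ true
      qs  : A q s ≡ false
      rs  : A r s ≡ false

  PawFreeOn : VSet n → Set
  PawFreeOn K = ∀ {p q r s} → p ∈ K → q ∈ K → r ∈ K → s ∈ K → IsPaw p q r s → ⊥

  paw-free-beside : Free (P 1 ⊹ paw) G → ∀ {K z} → (∀ {v} → v ∈ K → A z v ≡ false × z ≢ v) → PawFreeOn K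
  paw-free-beside free {K} {z} apart {p} {q} {r} {s} p∈ q∈ r∈ s∈ (paw-shape pq pr qr ps qs rs) =
    free (f , faithful⇒injective (P 1 ⊹ paw) f faithful separated , faithful)
    where
    f : Fin 5 → V
    f 0F = z
    f 1F = p
    f 2F = q
    f 3F = s
    f 4F = r
    separated : ∀ i j → i ≢ j → Separated (P 1 ⊹ paw) i j
    separated = from-yes (all? λ i → all? λ j → ¬? (i F.≟ j) →-dec
                  ((adj (P 1 ⊹ paw) i j Bool.≟ true) ⊎-dec any? (λ k → ¬? (adj (P 1 ⊹ paw) i k Bool.≟ adj (P 1 ⊹ paw) j k))))
    z-p : A z p ≡ false
    z-p = proj₁ (apart p∈)
    z-q : A z q ≡ false
    z-q = proj₁ (apart q∈)
    z-r : A z r ≡ false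
    z-r = proj₁ (apart r∈)
    z-s : A z s ≡ false
    z-s = proj₁ (apart s∈)
    faithful : ∀ i j → adj (P 1 ⊹ paw) i j ≡ A (f i) (f j)
    faithful 0F 0F = sym (A-irrefl z)
    faithful 0F 1F = sym z-p
    faithful 0F 2F = sym z-q
    faithful 0F 3F = sym z-s
    faithful 0F 4F = sym z-r
    faithful 1F 0F = sym (A-swap z-p)
    faithful 1F 1F = sym (A-irrefl p)
    faithful 1F 2F = sym pq
    faithful 1F 3F = sym ps
    faithful 1F 4F = sym pr
    faithful 2F 0F = sym (A-swap z-q)
    faithful 2F 1F = sym (A-swap pq)
    faithful 2F 2F = sym (A-irrefl q)
    faithful 2F 3F = sym qs
    faithful 2F 4F = sym qr
    faithful 3F 0F = sym (A-swap z-s)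
    faithful 3F 1F = sym (A-swap ps)
    faithful 3F 2F = sym (A-swap qs)
    faithful 3F 3F = sym (A-irrefl s)
    faithful 3F 4F = sym (A-swap rs)
    faithful 4F 0F = sym (A-swap z-r)
    faithful 4F 1F = sym (A-swap pr)
    faithful 4F 2F = sym (A-swap qr)
    faithful 4F 3F = sym rs
    faithful 4F 4F = sym (A-irrefl r)

  -- In a disconnected (P₁ + paw)-free graph the component of every vertex is paw-free:
  -- a vertex outside it is isolated from any paw inside it.
  component-paw-free : Free (P 1 ⊹ paw) G → Disconnected G → ∀ a →
                       PawFreeOn (Component.members (component everything a refl))
  component-paw-free free disconnected a with outside disconnected a
  ... | z , z∉K = paw-free-beside free apart
    where
    K : Component everything a
    K = component everything a refl
    apart : ∀ {v} → v ∈ Component.members K → A z v ≡ false × z ≢ v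
    apart {v} v∈K = non-adjacent , λ { refl → true≢false v∈K z∉K }
      where
      non-adjacent : A z v ≡ false
      non-adjacent with A z v in e
      ... | false = refl
      ... | true = ⊥-elim (true≢false (Component.closed K v∈K refl (A-swap e)) z∉K)

  PawFreeOn-⊆ : ∀ {T K} → T ⊆ K → PawFreeOn K → PawFreeOn T
  PawFreeOn-⊆ T⊆K paw-free p∈ q∈ r∈ s∈ = paw-free (T⊆K _ p∈) (T⊆K _ q∈) (T⊆K _ r∈) (T⊆K _ s∈)

  module Around-triangle (chordal : Chordal G) {K : VSet n} (paw-free : PawFreeOn K)
                         {a b c : V} (a∈K : a ∈ K) (b∈K : b ∈ K) (c∈K : c ∈ K)
                         (ab : A a b ≡ true) (bc : A b c ≡ true) (ac : A a c ≡ true)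
                         (reach : ∀ {v} → v ∈ K → Walk K a v) where

    SeesTwo : V → Set
    SeesTwo v = (A v a ≡ true × A v b ≡ true) ⊎ (A v a ≡ true × A v c ≡ true) ⊎ (A v b ≡ true × A v c ≡ true)

    Good : V → Set
    Good v = v ≡ a ⊎ v ≡ b ⊎ v ≡ c ⊎ SeesTwo v

    -- A neighbour of a good vertex is good: otherwise it is the pendant of a paw.
    good-step : ∀ {u v} → u ∈ K → v ∈ K → Good u → A u v ≡ true → Good v
    good-step {u} {v} u∈K v∈K good-u uv with A v a in va | A v b in vb | A v c in vc
    ... | true  | true  | _     = inj₂ (inj₂ (inj₂ (inj₁ (refl , refl))))
    ... | true  | false | true  = inj₂ (inj₂ (inj₂ (inj₂ (inj₁ (refl , refl)))))
    ... | false | true  | true  = inj₂ (inj₂ (inj₂ (inj₂ (inj₂ (refl , refl)))))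
    ... | true  | false | false = ⊥-elim (paw-free a∈K b∈K c∈K v∈K
          (paw-shape ab ac bc (A-swap va) (A-swap vb) (A-swap vc)))
    ... | false | true  | false = ⊥-elim (paw-free b∈K a∈K c∈K v∈K
          (paw-shape (A-swap ab) bc ac (A-swap vb) (A-swap va) (A-swap vc)))
    ... | false | false | true  = ⊥-elim (paw-free c∈K a∈K b∈K v∈K
          (paw-shape (A-swap ac) (A-swap bc) ab (A-swap vc) (A-swap va) (A-swap vb)))
    ... | false | false | false = ⊥-elim (isolated good-u)
      where
      isolated : Good u → ⊥
      isolated (inj₁ refl) = true≢false (A-swap uv) va
      isolated (inj₂ (inj₁ refl)) = true≢false (A-swap uv) vb
      isolated (inj₂ (inj₂ (inj₁ refl))) = true≢false (A-swap uv) vc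
      isolated (inj₂ (inj₂ (inj₂ (inj₁ (ua , ub))))) = paw-free u∈K a∈K b∈K v∈K
        (paw-shape ua ub ab uv (A-swap va) (A-swap vb))
      isolated (inj₂ (inj₂ (inj₂ (inj₂ (inj₁ (ua , uc)))))) = paw-free u∈K a∈K c∈K v∈K
        (paw-shape ua uc ac uv (A-swap va) (A-swap vc))
      isolated (inj₂ (inj₂ (inj₂ (inj₂ (inj₂ (ub , uc)))))) = paw-free u∈K b∈K c∈K v∈K
        (paw-shape ub uc bc uv (A-swap vb) (A-swap vc))

    good-along : ∀ {u v} → u ∈ K → Good u → Walk K u v → Good v
    good-along u∈K good-u [] = good-u
    good-along u∈K good-u ((w∈K , uw) ∷ walk) = good-along w∈K (good-step u∈K w∈K good-u uw) walk

    good : ∀ {v} → v ∈ K → Good v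
    good v∈K = good-along a∈K (inj₁ refl) (reach v∈K)

    sees-b-c : ∀ {w} → w ∈ K → w ≢ a → A a w ≡ false → A w b ≡ true × A w c ≡ true
    sees-b-c w∈K w≢a aw with good w∈K
    ... | inj₁ w≡a = ⊥-elim (w≢a w≡a)
    ... | inj₂ (inj₁ refl) = ⊥-elim (true≢false ab aw)
    ... | inj₂ (inj₂ (inj₁ refl)) = ⊥-elim (true≢false ac aw)
    ... | inj₂ (inj₂ (inj₂ (inj₁ (wa , _)))) = ⊥-elim (true≢false (A-swap wa) aw)
    ... | inj₂ (inj₂ (inj₂ (inj₂ (inj₁ (wa , _))))) = ⊥-elim (true≢false (A-swap wa) aw)
    ... | inj₂ (inj₂ (inj₂ (inj₂ (inj₂ wb,wc)))) = wb,wc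

    -- If a misses some w ∈ K, then b is adjacent to all of K: a vertex v missed by b
    -- sees a and c, and then w b a v is an induced C₄ or c v a w a paw.
    b-universal : ∀ {w} → w ∈ K → w ≢ a → A a w ≡ false → ∀ {v} → v ∈ K → v ≢ b → A b v ≡ true
    b-universal {w} w∈K w≢a aw {v} v∈K v≢b with A b v in bv
    ... | true = refl
    ... | false with good v∈K
    ...   | inj₁ refl = ⊥-elim (true≢false (A-swap ab) bv)
    ...   | inj₂ (inj₁ v≡b) = ⊥-elim (v≢b v≡b)
    ...   | inj₂ (inj₂ (inj₁ refl)) = ⊥-elim (true≢false bc bv)
    ...   | inj₂ (inj₂ (inj₂ (inj₁ (_ , vb)))) = ⊥-elim (true≢false (A-swap vb) bv)
    ...   | inj₂ (inj₂ (inj₂ (inj₂ (inj₂ (vb , _))))) = ⊥-elim (true≢false (A-swap vb) bv)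
    ...   | inj₂ (inj₂ (inj₂ (inj₂ (inj₁ (va , vc))))) with sees-b-c w∈K w≢a aw | A w v in wv
    ...     | wb , _ | true = ⊥-elim (no-C4 chordal wb (A-swap ab) (A-swap va) (A-swap wv) (A-swap aw) bv
                                      w≢a (λ b≡v → v≢b (sym b≡v)))
    ...     | _ , wc | false = ⊥-elim (paw-free c∈K v∈K a∈K w∈K
                                       (paw-shape (A-swap vc) (A-swap ac) va (A-swap wc) (A-swap wv) aw))

    -- K has a universal vertex: a, unless a misses some w ∈ K, and then b.
    universal : ∃ λ u → u ∈ K × (∀ {v} → v ∈ K → v ≢ u → A u v ≡ true)
    universal with search (λ w → K w ∧ not (w == a) ∧ not (A a w))
    ... | inj₂ none = a , a∈K , λ {v} v∈K v≢a → a-sees v∈K v≢a (none v)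
      where
      a-sees : ∀ {v} → v ∈ K → v ≢ a → K v ∧ not (v == a) ∧ not (A a v) ≡ false → A a v ≡ true
      a-sees {v} v∈K v≢a e with A a v
      ... | true = refl
      ... | false rewrite v∈K | ≢⇒==-false v≢a = ⊥-elim (true≢false refl e)
    ... | inj₁ (w , found) = b , b∈K , b-universal w∈K w≢a aw
      where
      w∈K : w ∈ K
      w∈K = Bool.∧-conicalˡ (K w) _ found
      aw : A a w ≡ false
      aw = Bool.not-injective (Bool.∧-conicalʳ (not (w == a)) _ (Bool.∧-conicalʳ (K w) _ found))
      w≢a : w ≢ a
      w≢a refl = true≢false (==-refl w)
                   (Bool.not-injective (Bool.∧-conicalˡ (not (w == w)) _ (Bool.∧-conicalʳ (K w) _ found)))

  -- A 3-expression building G[S] in which every vertex v of S carries the label L v.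
  record Rep (S : VSet n) (L : V → Fin 3) : Set where
    field
      m          : ℕ
      enum       : Fin m → V
      enum-inj   : ∀ {i j} → enum i ≡ enum j → i ≡ j
      enum-∈     : ∀ i → enum i ∈ S
      enum-onto  : ∀ v → v ∈ S → ∃ λ i → enum i ≡ v
      expr       : Expr 3 m
      expr-edge  : ∀ i j → edge expr i j ≡ A (enum i) (enum j)
      expr-label : ∀ i → label expr i ≡ L (enum i)

  rep-vertex : ∀ x L → Rep ⁅ x ⁆ L
  rep-vertex x L = record
    { m = 1 ; enum = λ _ → x ; enum-inj = λ { {0F} {0F} _ → refl }
    ; enum-∈ = λ _ → x∈⁅x⁆ x ; enum-onto = λ v v∈ → 0F , sym (∈⁅⁆⇒≡ v∈)
    ; expr = vtx (L x) ; expr-edge = λ _ _ → sym (A-irrefl x) ; expr-label = λ _ → refl }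

  rep-cong : ∀ {S S′ L L′} → (∀ v → S v ≡ S′ v) → (∀ v → v ∈ S → L v ≡ L′ v) → Rep S L → Rep S′ L′
  rep-cong S≗S′ L≗L′ r = record
    { m = m ; enum = enum ; enum-inj = enum-inj
    ; enum-∈ = λ i → trans (sym (S≗S′ _)) (enum-∈ i)
    ; enum-onto = λ v v∈S′ → enum-onto v (trans (S≗S′ v) v∈S′)
    ; expr = expr ; expr-edge = expr-edge
    ; expr-label = λ i → trans (expr-label i) (L≗L′ _ (enum-∈ i)) }
    where open Rep r

  rename : Fin 3 → Fin 3 → Fin 3 → Fin 3
  rename i j l = if l == i then j else l

  rep-rename : ∀ {S L} L′ i j → (∀ v → v ∈ S → rename i j (L v) ≡ L′ v) → Rep S L → Rep S L′
  rep-rename L′ i j renamed r = record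
    { m = m ; enum = enum ; enum-inj = enum-inj ; enum-∈ = enum-∈ ; enum-onto = enum-onto
    ; expr = ρ i j expr ; expr-edge = expr-edge
    ; expr-label = λ u → trans (cong (rename i j) (expr-label u)) (renamed _ (enum-∈ u)) }
    where open Rep r

  module Glue {S P : VSet n} {L : V → Fin 3} (P⊆S : P ⊆ S) (r₁ : Rep P L) (r₂ : Rep (S ∖ P) L) where

    private
      m₁ m₂ : ℕ
      m₁ = Rep.m r₁
      m₂ = Rep.m r₂
      e₁ : Expr 3 m₁
      e₁ = Rep.expr r₁
      e₂ : Expr 3 m₂
      e₂ = Rep.expr r₂

    enum : Fin (m₁ + m₂) → V
    enum u = [ Rep.enum r₁ , Rep.enum r₂ ]′ (splitAt m₁ u)

    disjoint : ∀ a b → Rep.enum r₁ a ≢ Rep.enum r₂ b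
    disjoint a b e = true≢false (Rep.enum-∈ r₁ a) (subst (_∉ P) (sym e) (∖-excl S P (Rep.enum-∈ r₂ b)))

    enum-inj : ∀ {u v} → enum u ≡ enum v → u ≡ v
    enum-inj {u} {v} e with splitAt m₁ u in eu | splitAt m₁ v in ev
    ... | inj₁ a | inj₁ b = trans (sym (splitAt⁻¹-↑ˡ eu)) (trans (cong (_↑ˡ m₂) (Rep.enum-inj r₁ e)) (splitAt⁻¹-↑ˡ ev))
    ... | inj₂ a | inj₂ b = trans (sym (splitAt⁻¹-↑ʳ eu)) (trans (cong (m₁ ↑ʳ_) (Rep.enum-inj r₂ e)) (splitAt⁻¹-↑ʳ ev))
    ... | inj₁ a | inj₂ b = ⊥-elim (disjoint a b e)
    ... | inj₂ a | inj₁ b = ⊥-elim (disjoint b a (sym e))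

    enum-∈ : ∀ u → enum u ∈ S
    enum-∈ u with splitAt m₁ u
    ... | inj₁ a = P⊆S _ (Rep.enum-∈ r₁ a)
    ... | inj₂ b = ∖-⊆ S P _ (Rep.enum-∈ r₂ b)

    enum-onto : ∀ v → v ∈ S → ∃ λ u → enum u ≡ v
    enum-onto v v∈S with ∈-split S P v∈S
    ... | inj₁ v∈P with Rep.enum-onto r₁ v v∈P
    ...   | a , refl = a ↑ˡ m₂ , cong [ Rep.enum r₁ , Rep.enum r₂ ]′ (splitAt-↑ˡ m₁ a m₂)
    enum-onto v v∈S | inj₂ v∈S∖P with Rep.enum-onto r₂ v v∈S∖P
    ...   | b , refl = m₁ ↑ʳ b , cong [ Rep.enum r₁ , Rep.enum r₂ ]′ (splitAt-↑ʳ m₁ m₂ b)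

    ⊕-label : ∀ u → label (e₁ ⊕ e₂) u ≡ L (enum u)
    ⊕-label u with splitAt m₁ u
    ... | inj₁ a = Rep.expr-label r₁ a
    ... | inj₂ b = Rep.expr-label r₂ b

    glue : (e : Expr 3 (m₁ + m₂)) → (∀ u → label e u ≡ label (e₁ ⊕ e₂) u) →
           (∀ u v → edge e u v ≡ A (enum u) (enum v)) → Rep S L
    glue e same-label e-edge = record
      { m = m₁ + m₂ ; enum = enum ; enum-inj = enum-inj ; enum-∈ = enum-∈ ; enum-onto = enum-onto
      ; expr = e ; expr-edge = e-edge ; expr-label = λ u → trans (same-label u) (⊕-label u) }

    union : (∀ {u v} → u ∈ P → v ∈ S ∖ P → A u v ≡ false) → Rep S L
    union no-cross = glue (e₁ ⊕ e₂) (λ _ → refl) union-edge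
      where
      union-edge : ∀ u v → edge (e₁ ⊕ e₂) u v ≡ A (enum u) (enum v)
      union-edge u v with splitAt m₁ u | splitAt m₁ v
      ... | inj₁ a | inj₁ b = Rep.expr-edge r₁ a b
      ... | inj₂ a | inj₂ b = Rep.expr-edge r₂ a b
      ... | inj₁ a | inj₂ b = sym (no-cross (Rep.enum-∈ r₁ a) (Rep.enum-∈ r₂ b))
      ... | inj₂ a | inj₁ b = sym (A-swap (no-cross (Rep.enum-∈ r₁ b) (Rep.enum-∈ r₂ a)))

    union-join : ∀ i j → i ≢ j → (∀ {u} → u ∈ P → L u ≢ j) → (∀ {v} → v ∈ S ∖ P → L v ≢ i) →
                 (∀ {u v} → u ∈ P → v ∈ S ∖ P → A u v ≡ (L u == i) ∧ (L v == j)) → Rep S L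
    union-join i j i≢j P-no-j rest-no-i cross = glue (η i j i≢j (e₁ ⊕ e₂)) (λ _ → refl) join-edge
      where
      P-label-j : ∀ a → (label e₁ a == j) ≡ false
      P-label-j a = trans (cong (_== j) (Rep.expr-label r₁ a)) (≢⇒==-false (P-no-j (Rep.enum-∈ r₁ a)))
      rest-label-i : ∀ b → (label e₂ b == i) ≡ false
      rest-label-i b = trans (cong (_== i) (Rep.expr-label r₂ b)) (≢⇒==-false (rest-no-i (Rep.enum-∈ r₂ b)))
      join-edge : ∀ u v → edge (η i j i≢j (e₁ ⊕ e₂)) u v ≡ A (enum u) (enum v)
      join-edge u v with splitAt m₁ u | splitAt m₁ v
      ... | inj₁ a | inj₁ b =
        trans (∨-falses _ (∧-false-r (P-label-j b)) (∧-false-l (P-label-j a))) (Rep.expr-edge r₁ a b)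
      ... | inj₂ a | inj₂ b =
        trans (∨-falses _ (∧-false-l (rest-label-i a)) (∧-false-r (rest-label-i b))) (Rep.expr-edge r₂ a b)
      ... | inj₁ a | inj₂ b = begin
        ((label e₁ a == i) ∧ (label e₂ b == j)) ∨ ((label e₁ a == j) ∧ (label e₂ b == i))
          ≡⟨ ∨-false-r (∧-false-l (P-label-j a)) ⟩
        (label e₁ a == i) ∧ (label e₂ b == j)
          ≡⟨ cong₂ (λ p q → (p == i) ∧ (q == j)) (Rep.expr-label r₁ a) (Rep.expr-label r₂ b) ⟩
        (L (Rep.enum r₁ a) == i) ∧ (L (Rep.enum r₂ b) == j)
          ≡⟨ sym (cross (Rep.enum-∈ r₁ a) (Rep.enum-∈ r₂ b)) ⟩
        A (Rep.enum r₁ a) (Rep.enum r₂ b) ∎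
      ... | inj₂ a | inj₁ b = begin
        ((label e₂ a == i) ∧ (label e₁ b == j)) ∨ ((label e₂ a == j) ∧ (label e₁ b == i))
          ≡⟨ ∨-false-l (∧-false-l (rest-label-i a)) ⟩
        (label e₂ a == j) ∧ (label e₁ b == i)
          ≡⟨ cong₂ (λ p q → (p == j) ∧ (q == i)) (Rep.expr-label r₂ a) (Rep.expr-label r₁ b) ⟩
        (L (Rep.enum r₂ a) == j) ∧ (L (Rep.enum r₁ b) == i)
          ≡⟨ Bool.∧-comm (L (Rep.enum r₂ a) == j) _ ⟩
        (L (Rep.enum r₁ b) == i) ∧ (L (Rep.enum r₂ a) == j)
          ≡⟨ sym (cross (Rep.enum-∈ r₁ b) (Rep.enum-∈ r₂ a)) ⟩
        A (Rep.enum r₁ b) (Rep.enum r₂ a)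
          ≡⟨ A-sym _ _ ⟩
        A (Rep.enum r₂ a) (Rep.enum r₁ b) ∎

  -- If P ⊆ S has no edge to S ∖ P, a representation of P extends to one of S
  -- using a representation of the rest (when the rest is non-empty).
  rep-extend : ∀ {S P L} → P ⊆ S → Rep P L → (∀ w → w ∈ S ∖ P → Rep (S ∖ P) L) →
               (∀ {u v} → u ∈ P → v ∈ S ∖ P → A u v ≡ false) → Rep S L
  rep-extend {S} {P} P⊆S r rest no-cross with search (S ∖ P)
  ... | inj₁ (w , w∈) = Glue.union P⊆S r (rest w w∈) no-cross
  ... | inj₂ empty = rep-cong P≗S (λ _ _ → refl) r
    where
    P≗S : ∀ v → P v ≡ S v
    P≗S v with P v in pv | S v in sv
    ... | true  | true  = refl
    ... | false | false = refl
    ... | true  | false = ⊥-elim (true≢false (P⊆S v pv) sv)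
    ... | false | true  = ⊥-elim (true≢false (∖-∈ S P sv pv) (empty v))

  rooted : V → V → Fin 3
  rooted x v = if v == x then 0F else 1F

  flat : V → Fin 3
  flat _ = 1F

  rooted-root : ∀ x → rooted x x ≡ 0F
  rooted-root x rewrite ==-refl x = refl

  rooted-other : ∀ {x v} → v ≢ x → rooted x v ≡ 1F
  rooted-other v≢x rewrite ≢⇒==-false v≢x = refl

  flatten : ∀ x v → rename 0F 1F (rooted x v) ≡ 1F
  flatten x v with v == x
  ... | true = refl
  ... | false = refl

  add-universal : ∀ {K u} → u ∈ K → (∀ {v} → v ∈ K → v ≢ u → A u v ≡ true) →
                  Rep (K ∖ ⁅ u ⁆) flat → Rep K flat
  add-universal {K} {u} u∈K universal core =
    rep-rename flat 0F 1F (λ v _ → flatten u v)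
      (Glue.union-join ⁅u⁆⊆K (rep-vertex u (rooted u)) core′ 0F 1F (λ ()) not-1 not-0 cross)
    where
    ⁅u⁆⊆K : ⁅ u ⁆ ⊆ K
    ⁅u⁆⊆K v v∈ rewrite ∈⁅⁆⇒≡ v∈ = u∈K
    core′ : Rep (K ∖ ⁅ u ⁆) (rooted u)
    core′ = rep-cong (λ _ → refl) (λ v v∈ → sym (rooted-other (∖⁅⁆-≢ K v∈))) core
    not-1 : ∀ {v} → v ∈ ⁅ u ⁆ → rooted u v ≢ 1F
    not-1 v∈ rewrite ∈⁅⁆⇒≡ v∈ | rooted-root u = λ ()
    not-0 : ∀ {v} → v ∈ K ∖ ⁅ u ⁆ → rooted u v ≢ 0F
    not-0 v∈ rewrite rooted-other (∖⁅⁆-≢ K v∈) = λ ()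
    cross : ∀ {w v} → w ∈ ⁅ u ⁆ → v ∈ K ∖ ⁅ u ⁆ → A w v ≡ (rooted u w == 0F) ∧ (rooted u v == 1F)
    cross {w} {v} w∈ v∈ rewrite ∈⁅⁆⇒≡ w∈ | rooted-root u | rooted-other (∖⁅⁆-≢ K v∈) =
      universal (∖-⊆ K ⁅ u ⁆ v v∈) (∖⁅⁆-≢ K v∈)

  Smaller : VSet n → Set
  Smaller S = ∀ {T z} → T ⊆ S → ∣ T ∣ < ∣ S ∣ → z ∈ T → Rep T (rooted z)

  isolated-root : ∀ {S x} → x ∈ S → (∀ {v} → v ∈ S → A x v ≡ false) → Smaller S → Rep S (rooted x)
  isolated-root {S} {x} x∈S isolated build = rep-extend ⁅x⁆⊆S (rep-vertex x (rooted x)) rest no-cross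
    where
    ⁅x⁆⊆S : ⁅ x ⁆ ⊆ S
    ⁅x⁆⊆S v v∈ rewrite ∈⁅⁆⇒≡ v∈ = x∈S
    rest : ∀ w → w ∈ S ∖ ⁅ x ⁆ → Rep (S ∖ ⁅ x ⁆) (rooted x)
    rest w w∈ = rep-rename (rooted x) 0F 1F (λ v v∈ → trans (flatten w v) (sym (rooted-other (∖⁅⁆-≢ S v∈))))
                  (build (∖-⊆ S ⁅ x ⁆) (∣∣-mono-< (∖-⊆ S ⁅ x ⁆) (∖-∉ S ⁅ x ⁆ (x∈⁅x⁆ x)) x∈S) w∈)
    no-cross : ∀ {u v} → u ∈ ⁅ x ⁆ → v ∈ S ∖ ⁅ x ⁆ → A u v ≡ false
    no-cross u∈ v∈ rewrite ∈⁅⁆⇒≡ u∈ = isolated (∖-⊆ S ⁅ x ⁆ _ v∈)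

  -- Attaching along an edge x ~ y of a forest: the component D of y in S ∖ {x} is built
  -- rooted at y (relabelled 2), the rest S ∖ D rooted at x, and joining labels 2 and 0
  -- adds the single edge x y between them.
  module Attach (chordal : Chordal G) {S x y} (tf : TriangleFree S) (x∈S : x ∈ S) (y∈S : y ∈ S)
                (xy : A x y ≡ true) (build : Smaller S) where

    y≢x : y ≢ x
    y≢x y≡x = A⇒≢ xy (sym y≡x)

    y∈S-x : y ∈ S ∖ ⁅ x ⁆
    y∈S-x = ∖-∈ S ⁅ x ⁆ y∈S (∉⁅⁆ y≢x)

    D-comp : Component (S ∖ ⁅ x ⁆) y
    D-comp = component (S ∖ ⁅ x ⁆) y y∈S-x
    open Component D-comp renaming (members to D; root to y∈D)

    D⊆S : D ⊆ S
    D⊆S v v∈D = ∖-⊆ S ⁅ x ⁆ v (inside v v∈D)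

    D-≢x : ∀ {v} → v ∈ D → v ≢ x
    D-≢x v∈D = ∖⁅⁆-≢ S (inside _ v∈D)

    x∉D : x ∉ D
    x∉D with D x in e
    ... | true = ⊥-elim (D-≢x e refl)
    ... | false = refl

    rest-≢y : ∀ {v} → v ∈ S ∖ D → v ≢ y
    rest-≢y v∈ refl = true≢false y∈D (∖-excl S D v∈)

    L : V → Fin 3
    L v = if v == y then 2F else rooted x v

    L-y : ∀ {v} → v ≡ y → L v ≡ 2F
    L-y refl rewrite ==-refl y = refl

    L-other : ∀ {v} → v ≢ y → L v ≡ rooted x v
    L-other v≢y rewrite ≢⇒==-false v≢y = refl

    L≡2⇒ : ∀ {v} → L v ≡ 2F → v ≡ y
    L≡2⇒ {v} e with v F.≟ y | v F.≟ x
    ... | yes v≡y | _ = v≡y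
    L≡2⇒ () | no _ | yes _
    L≡2⇒ () | no _ | no _

    L≡0⇒ : ∀ {v} → L v ≡ 0F → v ≡ x
    L≡0⇒ {v} e with v F.≟ y | v F.≟ x
    ... | no _ | yes v≡x = v≡x
    L≡0⇒ () | yes _ | _
    L≡0⇒ () | no _ | no _

    -- The only edge between D and S ∖ D is y x: D is closed in S ∖ {x}, and a second
    -- neighbour of x in D would contradict the forest property.
    edge-out : ∀ {u v} → u ∈ D → v ∈ S ∖ D → A u v ≡ true → u ≡ y × v ≡ x
    edge-out {u} {v} u∈D v∈rest uv with v F.≟ x
    ... | no v≢x = ⊥-elim (true≢false (closed u∈D (∖-∈ S ⁅ x ⁆ (∖-⊆ S D v v∈rest) (∉⁅⁆ v≢x)) uv) (∖-excl S D v∈rest))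
    ... | yes refl with u F.≟ y
    ...   | yes u≡y = u≡y , refl
    ...   | no u≢y = ⊥-elim (forest-property chordal tf x∈S (λ y≡u → u≢y (sym y≡u)) xy (A-swap uv) y∈S-x
                               (walk-mono inside (reach u u∈D)))

    cross : ∀ {u v} → u ∈ D → v ∈ S ∖ D → A u v ≡ (L u == 2F) ∧ (L v == 0F)
    cross {u} {v} u∈D v∈rest = Bool.⇔→≡ (mk⇔ to from)
      where
      to : A u v ≡ true → (L u == 2F) ∧ (L v == 0F) ≡ true
      to uv with edge-out u∈D v∈rest uv
      ... | refl , refl = cong₂ (λ p q → (p == 2F) ∧ (q == 0F)) (L-y refl)
                            (trans (L-other (λ x≡y → y≢x (sym x≡y))) (rooted-root x))
      from : (L u == 2F) ∧ (L v == 0F) ≡ true → A u v ≡ true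
      from e with L≡2⇒ {u} (==⇒≡ (Bool.∧-conicalˡ (L u == 2F) _ e)) | L≡0⇒ {v} (==⇒≡ (Bool.∧-conicalʳ (L u == 2F) _ e))
      ... | refl | refl = A-swap xy

    r-D : Rep D L
    r-D = rep-rename L 0F 2F D-label (build D⊆S (∣∣-mono-< D⊆S x∉D x∈S) y∈D)
      where
      D-label : ∀ v → v ∈ D → rename 0F 2F (rooted y v) ≡ L v
      D-label v v∈D with v F.≟ y
      ... | yes refl = refl
      ... | no v≢y rewrite rooted-other (D-≢x v∈D) = refl

    r-rest : Rep (S ∖ D) L
    r-rest = rep-cong (λ _ → refl) (λ v v∈ → sym (L-other (rest-≢y v∈)))
               (build (∖-⊆ S D) (∣∣-mono-< (∖-⊆ S D) (∖-∉ S D y∈D) y∈S) (∖-∈ S D x∈S x∉D))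

    attached : Rep S (rooted x)
    attached = rep-rename (rooted x) 2F 1F relabel
                 (Glue.union-join D⊆S r-D r-rest 2F 0F (λ ()) D-not-0 rest-not-2 cross)
      where
      D-not-0 : ∀ {u} → u ∈ D → L u ≢ 0F
      D-not-0 {u} u∈D with u F.≟ y
      ... | yes refl = λ ()
      ... | no u≢y rewrite rooted-other (D-≢x u∈D) = λ ()
      rest-not-2 : ∀ {v} → v ∈ S ∖ D → L v ≢ 2F
      rest-not-2 {v} v∈ rewrite L-other (rest-≢y v∈) with v == x
      ... | true = λ ()
      ... | false = λ ()
      relabel : ∀ v → v ∈ S → rename 2F 1F (L v) ≡ rooted x v
      relabel v _ with v F.≟ y
      ... | yes refl rewrite rooted-other y≢x = refl
      ... | no v≢y with v == x
      ...   | true = refl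
      ...   | false = refl

  forest-rep : Chordal G → ∀ bound {S x} → ∣ S ∣ < bound → TriangleFree S → x ∈ S → Rep S (rooted x)
  forest-rep chordal (suc bound) {S} {x} size tf x∈S = by-root-degree (search (λ v → S v ∧ A x v))
    where
    build : Smaller S
    build T⊆S smaller = forest-rep chordal bound (≤-trans smaller (≤-pred size)) (TriangleFree-⊆ T⊆S tf)
    by-root-degree : (∃ λ y → S y ∧ A x y ≡ true) ⊎ (∀ v → S v ∧ A x v ≡ false) → Rep S (rooted x)
    by-root-degree (inj₁ (y , found)) =
      Attach.attached chordal tf x∈S (Bool.∧-conicalˡ (S y) _ found) (Bool.∧-conicalʳ (S y) _ found) build
    by-root-degree (inj₂ none) = isolated-root x∈S isolated build
      where
      isolated : ∀ {v} → v ∈ S → A x v ≡ false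
      isolated {v} v∈S = subst (λ b → b ∧ A x v ≡ false) v∈S (none v)

  record Apex (S : VSet n) : Set where
    field
      Cₜ        : VSet n
      Cₜ⊆S      : Cₜ ⊆ S
      Cₜ-closed : ∀ {u v} → u ∈ Cₜ → v ∈ S → A u v ≡ true → v ∈ Cₜ
      u         : V
      u∈Cₜ      : u ∈ Cₜ
      universal : ∀ {v} → v ∈ Cₜ → v ≢ u → A u v ≡ true
      o         : V
      o∈Cₜ-u    : o ∈ Cₜ ∖ ⁅ u ⁆

  -- A triangle of G[S] yields an apex: Cₜ is paw-free as part of a component of G.
  apex : Chordal G → Free (P 1 ⊹ paw) G → Disconnected G → ∀ {S} → Triangle S → Apex S
  apex chordal free disconnected {S} (triangle {a} {b} {c} a∈ b∈ c∈ ab bc ac) =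
    from-universal (Around-triangle.universal chordal paw-free root b∈Cₜ c∈Cₜ ab bc ac (λ {v} → reach v))
    where
    open Component (component S a a∈) renaming (members to Cₜ)
    b∈Cₜ : b ∈ Cₜ
    b∈Cₜ = closed root b∈ ab
    c∈Cₜ : c ∈ Cₜ
    c∈Cₜ = closed root c∈ ac
    paw-free : PawFreeOn Cₜ
    paw-free = PawFreeOn-⊆ (λ v v∈Cₜ → walk-stays (component everything a refl) (walk-mono (λ _ _ → refl) (reach v v∈Cₜ)))
                 (component-paw-free free disconnected a)
    other : ∀ u → ∃ λ o → o ∈ Cₜ ∖ ⁅ u ⁆
    other u with u F.≟ a
    ... | yes refl = b , ∖-∈ Cₜ ⁅ u ⁆ b∈Cₜ (∉⁅⁆ λ b≡a → A⇒≢ ab (sym b≡a))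
    ... | no u≢a = a , ∖-∈ Cₜ ⁅ u ⁆ root (∉⁅⁆ λ a≡u → u≢a (sym a≡u))
    from-universal : (∃ λ u → u ∈ Cₜ × (∀ {v} → v ∈ Cₜ → v ≢ u → A u v ≡ true)) → Apex S
    from-universal (u , u∈Cₜ , universal) = record
      { Cₜ = Cₜ ; Cₜ⊆S = inside ; Cₜ-closed = closed ; u = u ; u∈Cₜ = u∈Cₜ ; universal = universal
      ; o = proj₁ (other u) ; o∈Cₜ-u = proj₂ (other u) }

  cw-rep : Chordal G → Free (P 1 ⊹ paw) G → Disconnected G → ∀ bound {S w} → ∣ S ∣ < bound → w ∈ S → Rep S flat
  cw-rep chordal free disconnected (suc bound) {S} {w} size w∈S with triangle? S
  ... | inj₂ tf = rep-rename flat 0F 1F (λ v _ → flatten w v) (forest-rep chordal (suc bound) size tf w∈S)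
  ... | inj₁ t = rep-extend Cₜ⊆S (add-universal u∈Cₜ universal core) rest no-cross
    where
    open Apex (apex chordal free disconnected t)
    recurse : ∀ {T x} → T ⊆ S → ∣ T ∣ < ∣ S ∣ → x ∈ T → Rep T flat
    recurse T⊆S smaller = cw-rep chordal free disconnected bound (≤-trans smaller (≤-pred size))
    core : Rep (Cₜ ∖ ⁅ u ⁆) flat
    core = recurse (λ v v∈ → Cₜ⊆S v (∖-⊆ Cₜ ⁅ u ⁆ v v∈))
             (≤-trans (∣∣-mono-< (∖-⊆ Cₜ ⁅ u ⁆) (∖-∉ Cₜ ⁅ u ⁆ (x∈⁅x⁆ u)) u∈Cₜ) (∣∣-mono Cₜ⊆S)) o∈Cₜ-u
    rest : ∀ w′ → w′ ∈ S ∖ Cₜ → Rep (S ∖ Cₜ) flat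
    rest w′ = recurse (∖-⊆ S Cₜ) (∣∣-mono-< (∖-⊆ S Cₜ) (∖-∉ S Cₜ u∈Cₜ) (Cₜ⊆S u u∈Cₜ))
    no-cross : ∀ {p q} → p ∈ Cₜ → q ∈ S ∖ Cₜ → A p q ≡ false
    no-cross {p} {q} p∈Cₜ q∈rest with A p q in pq
    ... | false = refl
    ... | true = ⊥-elim (true≢false (Cₜ-closed p∈Cₜ (∖-⊆ S Cₜ q q∈rest) pq) (∖-excl S Cₜ q∈rest))

  rep⇒CW : ∀ {L} → Rep everything L → CW≤ 3 G
  rep⇒CW r = as-permutation (≤-antisym (injective⇒≤ enum-inj) (injective⇒≤ back-inj)) expr enum back
               enum-back back-enum expr-edge
    where
    open Rep r
    back : V → Fin m
    back v = proj₁ (enum-onto v refl)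
    enum-back : ∀ v → enum (back v) ≡ v
    enum-back v = proj₂ (enum-onto v refl)
    back-enum : ∀ i → back (enum i) ≡ i
    back-enum i = enum-inj (enum-back (enum i))
    back-inj : ∀ {u v} → back u ≡ back v → u ≡ v
    back-inj {u} {v} e = trans (sym (enum-back u)) (trans (cong enum e) (enum-back v))
    as-permutation : ∀ {k} → k ≡ n → (e : Expr 3 k) (f : Fin k → V) (f⁻¹ : V → Fin k) →
                     (∀ v → f (f⁻¹ v) ≡ v) → (∀ i → f⁻¹ (f i) ≡ i) →
                     (∀ i j → edge e i j ≡ A (f i) (f j)) → CW≤ 3 G
    as-permutation refl e f f⁻¹ ff⁻¹ f⁻¹f e-edge = e , mk↔ₛ′ f f⁻¹ ff⁻¹ f⁻¹f , e-edge

  -- The empty graph is connected, so a disconnected graph has a vertex.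
  some-vertex : Disconnected G → V
  some-vertex disconnected = first n refl
    where
    first : ∀ k → k ≡ n → V
    first zero k≡n = ⊥-elim (disconnected λ u → ⊥-elim (¬Fin0 (subst Fin (sym k≡n) u)))
    first (suc k) k≡n = subst Fin k≡n F.zero

  cw≤3 : Chordal G → Free (P 1 ⊹ paw) G → Disconnected G → CW≤ 3 G
  cw≤3 chordal free disconnected =
    rep⇒CW (cw-rep chordal free disconnected (suc n) {w = some-vertex disconnected} (s≤s (∣∣≤n everything)) refl)

lemma24 : ∃ λ (c : ℕ) → (G : Graph) → IsSimple G → Disconnected G →
            Free (P 1 ⊹ paw) G → Chordal G → CW≤ c G
lemma24 = 3 , λ G simple disconnected free chordal → cw≤3 G simple chordal free disconnected
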